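{- Let $\ell$ be a positive integer and let $\mathcal{S}$ be a signature of $Q_n$ such that $\varepsilon_k(\mathcal{S})\geq\ell$ for $1\leq k<n$. Let $X_1,\dots,X_\ell$ be distinct nonempty subsets of $[n]$ and let $x_t\in X_t$ for each $t$. Then there is an upright spanning tree $T$ of $Q_n$ with signature $\mathcal{S}$ such that $\psi_T(X_t)=x_t$ for $1\leq t\leq\ell$.
   Context: $[n]=\{1,\dots,n\}$. $Q_n$: vertices the subsets of $[n]$, edge between $X,Y$ iff $X\oplus Y=\{i\}$ for a single $i$ (the direction). $\mathrm{sig}(T)=(a_1,\dots,a_n)$ with $a_i$ the number of edges of the spanning tree $T$ in direction $i$; a signature of $Q_n$ is a tuple of this form. The excess of $\mathcal{S}=(a_1,\dots,a_n)$ at $k$ is $\varepsilon_k(\mathcal{S})=\min_{K\subseteq[n],|K|=k}\sum_{i\in K}a_i-(2^k-1)$. A spanning tree $T$ rooted at $\emptyset$ is upright if for each vertex $X$ the path in $T$ from $X$ to $\emptyset$ has length $|X|$; then for each nonempty $X$ the first vertex after $X$ on this path is $X-\{i\}$ for a unique $i\in X$, and one sets $\psi_T(X)=i$. -}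

module Defs where

open import Data.Nat using (ℕ; zero; suc; _+_; _∸_; _^_; _≤_)
open import Data.Bool using (Bool; true; false; not; if_then_else_)
open import Data.Fin using (Fin)
open import Data.Fin.Subset using (Subset; ∣_∣; ⊥)
open import Data.Vec using (Vec; []; _∷_; lookup; tabulate; _[_]≔_; zipWith)
import Data.Vec as V
open import Data.List using (List; []; _∷_; map; _++_; length)
open import Data.Nat.ListAction using (sum)
open import Data.List.Relation.Unary.Linked using (Linked)
open import Data.List.Relation.Unary.AllPairs using (AllPairs)
open import Data.Product using (Σ; ∃; _×_; _,_)
open import Relation.Binary.PropositionalEquality using (_≡_; _≢_)
open import Relation.Nullary using (¬_)

-- Vertices of Q_n are subsets of [n] (Data.Fin.Subset: Vec Bool n, true = member).
-- Enumeration of all 2^n subsets.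
allSubsets : (n : ℕ) → List (Subset n)
allSubsets zero = [] ∷ []
allSubsets (suc n) = map (true ∷_) (allSubsets n) ++ map (false ∷_) (allSubsets n)

toggle : ∀ {n} → Subset n → Fin n → Subset n
toggle X i = X [ i ]≔ not (lookup X i)

remove : ∀ {n} → Subset n → Fin n → Subset n
remove X i = X [ i ]≔ false

-- A set of edges of Q_n: T X i = true means the edge {X, X ⊕ {i}} is present.
EdgeSet : ℕ → Set
EdgeSet n = Subset n → Fin n → Bool

-- well-formedness: the two descriptions of the same (undirected) edge agree
IsEdgeSet : ∀ {n} → EdgeSet n → Set
IsEdgeSet T = ∀ X i → T X i ≡ T (toggle X i) i

Adj : ∀ {n} → EdgeSet n → Subset n → Subset n → Set
Adj T X Y = ∃ λ i → Y ≡ toggle X i × T X i ≡ true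

lastOf : ∀ {A : Set} → A → List A → A
lastOf a [] = a
lastOf a (b ∷ bs) = lastOf b bs

-- X ∷ ws is a path in T from X to Y (consecutive vertices adjacent,
-- all vertices distinct); its length (number of edges) is length ws.
Path : ∀ {n} → EdgeSet n → Subset n → Subset n → List (Subset n) → Set
Path T X Y ws = Linked (Adj T) (X ∷ ws) × AllPairs _≢_ (X ∷ ws) × lastOf X ws ≡ Y

HasCycle : ∀ {n} → EdgeSet n → Set
HasCycle {n} T = Σ (Subset n) λ v → Σ (List (Subset n)) λ ws →
  2 ≤ length ws × Linked (Adj T) (v ∷ ws) × AllPairs _≢_ (v ∷ ws) × Adj T (lastOf v ws) v

IsSpanningTree : ∀ {n} → EdgeSet n → Set
IsSpanningTree {n} T = IsEdgeSet T
  × (∀ (X Y : Subset n) → ∃ λ ws → Path T X Y ws)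
  × ¬ HasCycle T

-- number of edges of T in direction i (each edge counted at its endpoint not containing i)
dirCount : ∀ {n} → EdgeSet n → Fin n → ℕ
dirCount {n} T i = sum (map (λ X → if lookup X i then 0 else (if T X i then 1 else 0)) (allSubsets n))

sig : ∀ {n} → EdgeSet n → Vec ℕ n
sig T = tabulate (dirCount T)

IsSignature : ∀ {n} → Vec ℕ n → Set
IsSignature {n} S = Σ (EdgeSet n) λ T → IsSpanningTree T × sig T ≡ S

sumOver : ∀ {n} → Subset n → Vec ℕ n → ℕ
sumOver K S = V.sum (zipWith (λ b a → if b then a else 0) K S)

-- ε_k(S) ≥ ℓ, i.e. min_{|K|=k} ∑_{i∈K} a_i - (2^k - 1) ≥ ℓ, unfolded (minimum ≥ ℓ iff all ≥ ℓ)
ExcessAtLeast : ∀ {n} → Vec ℕ n → ℕ → ℕ → Set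
ExcessAtLeast {n} S k ℓ = ∀ (K : Subset n) → ∣ K ∣ ≡ k → ℓ + (2 ^ k ∸ 1) ≤ sumOver K S

Upright : ∀ {n} → EdgeSet n → Set
Upright {n} T = ∀ (X : Subset n) → ∃ λ ws → Path T X ⊥ ws × length ws ≡ ∣ X ∣

PsiIs : ∀ {n} → EdgeSet n → Subset n → Fin n → Set
PsiIs T X x = ∃ λ ws → Path T X ⊥ (remove X x ∷ ws)

-- An upright spanning tree T is the same thing as a choice of a parent X − {ψ(X)} for
-- every nonempty X, i.e. a function c with c X ∈ X; the signature of the resulting
-- tree counts, for each direction i, the nonempty X with c X = i.  So we need c with
-- c X_t = x_t whose fibres have sizes a_i.  This is a transportation problem: every
-- nonempty X is assigned a direction from allowed X ({x_t} if X = X_t, X otherwise) and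
-- direction i has capacity a_i.  By Hall's theorem with capacities it suffices that at
-- most ∑_{i∈K} a_i sets X have allowed X ⊆ K.  For 0 < |K| < n there are at most
-- (2^|K| − 1) + ℓ such X, which the excess hypothesis covers; for K = [n] there are
-- 2^n − 1, the number of edges of any spanning tree, which is ∑ a_i.  Since the
-- capacities add up to the number of nonempty sets, every fibre is then full.

module Submission where

open import Defs
open import Algebra.Properties.CommutativeSemigroup using (interchange)
open import Data.Nat using (ℕ; zero; suc; _+_; _∸_; _^_; _≤_; _<_; z≤n; s≤s; _≤?_)
open import Data.Nat.Properties
open import Data.Nat.ListAction using (sum)
open import Data.Nat.ListAction.Properties using (sum-++)
open import Data.Bool using (Bool; true; false; not; if_then_else_; _∧_; _∨_)
import Data.Bool.Properties as Boolₚ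
open import Data.Fin using (Fin; zero; suc)
import Data.Fin.Properties as Finₚ
open import Data.Fin.Subset using (Subset; ∣_∣; ⊥; ⊤; _∪_; _∩_; ⁅_⁆; ⋃; _∈_; _⊆_; Nonempty)
import Data.Fin.Subset.Properties as Subsetₚ
open Subsetₚ using (_⊆?_; _∈?_)
open import Data.Vec using (Vec; []; _∷_; lookup; _[_]≔_)
import Data.Vec as Vec
import Data.Vec.Properties as Vecₚ
open import Data.List using (List; []; _∷_; map; _++_; length; allFin; filter)
import Data.List.Properties as Listₚ
open import Data.List.Relation.Unary.All using (All; []; _∷_)
import Data.List.Relation.Unary.All as All
open import Data.List.Relation.Unary.Any using (here; there)
import Data.List.Relation.Unary.Any as Any
open import Data.List.Relation.Unary.All.Properties.Core using (¬Any⇒All¬; ¬All⇒Any¬)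
open import Data.List.Relation.Unary.Linked using (Linked; []; [-]; _∷_)
open import Data.List.Relation.Unary.AllPairs using (AllPairs; []; _∷_)
import Data.List.Relation.Unary.AllPairs as AllPairs
import Data.List.Relation.Unary.Linked as Linkedₚ
open import Data.List.Relation.Unary.Linked.Properties using (Linked⇒AllPairs)
open import Data.List.Relation.Unary.Unique.Propositional using (Unique)
open import Data.List.Membership.Propositional using () renaming (_∈_ to _∈ₗ_)
open import Data.List.Membership.Propositional.Properties using (∈-++⁺ˡ; ∈-++⁺ʳ; ∈-map⁺; ∈-map⁻; ∈-allFin; ∈-filter⁺)
import Data.List.Relation.Unary.Unique.Propositional.Properties as Uniqueₚ
open import Data.List.Relation.Binary.Disjoint.Propositional using (Disjoint)
open import Data.Product using (Σ; ∃; _×_; _,_; proj₁; proj₂)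
open import Data.Sum using (_⊎_; inj₁; inj₂)
import Data.Sum
open import Data.Empty using (⊥-elim) renaming (⊥ to ⊥₀)
open import Relation.Binary.PropositionalEquality
open import Relation.Binary.Definitions using (DecidableEquality)
open import Relation.Nullary using (¬_; ¬?; Dec; yes; no; does)
open import Relation.Nullary.Decidable using (dec-true; dec-false; _×-dec_)
import Relation.Nullary.Decidable as Dec
open import Relation.Unary using (Decidable)
open import Function using (_∘_; id)

+-interchange : ∀ a b c d → (a + b) + (c + d) ≡ (a + c) + (b + d)
+-interchange = interchange +-commutativeSemigroup

+-≤-tight : ∀ {a b c d} → a ≤ c → b ≤ d → a + b ≡ c + d → a ≡ c × b ≡ d
+-≤-tight {a} {b} {c} {d} a≤c b≤d eq = a≡c , +-cancelˡ-≡ c b d (trans (cong (_+ b) (sym a≡c)) eq)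
  where
  a≡c : a ≡ c
  a≡c = ≤-antisym a≤c (+-cancelʳ-≤ b c a (≤-trans (+-monoʳ-≤ c b≤d) (≤-reflexive (sym eq))))

𝟙 : Bool → ℕ
𝟙 b = if b then 1 else 0

𝟙≤1 : ∀ b → 𝟙 b ≤ 1
𝟙≤1 true = ≤-refl
𝟙≤1 false = z≤n

true≢false : true ≢ false
true≢false ()

not≢ : ∀ b → not b ≢ b
not≢ true ()
not≢ false ()

does-true⇒ : ∀ {P : Set} (P? : Dec P) → does P? ≡ true → P
does-true⇒ (yes p) _ = p

𝟙-exactly-one : ∀ {a b c} → (a ≡ true → c ≡ true) → (b ≡ true → c ≡ true) →
  (c ≡ true → a ≡ true ⊎ b ≡ true) → (a ≡ true → b ≡ true → ⊥₀) → 𝟙 a + 𝟙 b ≡ 𝟙 c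
𝟙-exactly-one {true} {true} _ _ _ ¬both = ⊥-elim (¬both refl refl)
𝟙-exactly-one {true} {false} a⇒c _ _ _ rewrite a⇒c refl = refl
𝟙-exactly-one {false} {true} _ b⇒c _ _ rewrite b⇒c refl = refl
𝟙-exactly-one {false} {false} {false} _ _ _ _ = refl
𝟙-exactly-one {false} {false} {true} _ _ c⇒a∨b _ with c⇒a∨b refl
... | inj₁ ()
... | inj₂ ()

if-split : ∀ b (x : ℕ) → x ≡ (if b then x else 0) + (if b then 0 else x)
if-split true x = sym (+-identityʳ x)
if-split false x = refl

if-+ : ∀ b {x y z : ℕ} → (b ≡ false → x + y ≡ z) →
  (if b then 0 else x) + (if b then 0 else y) ≡ (if b then 0 else z)
if-+ true _ = refl
if-+ false x+y≡z = x+y≡z refl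

if-not+if : ∀ b (x : ℕ) → (if not b then x else 0) + (if b then x else 0) ≡ x
if-not+if true x = refl
if-not+if false x = +-identityʳ x

private variable
  A B : Set

sumBy : (A → ℕ) → List A → ℕ
sumBy f xs = sum (map f xs)

sumBy-distrib-+ : ∀ (f g : A → ℕ) xs → sumBy (λ x → f x + g x) xs ≡ sumBy f xs + sumBy g xs
sumBy-distrib-+ f g [] = refl
sumBy-distrib-+ f g (x ∷ xs) =
  trans (cong (f x + g x +_) (sumBy-distrib-+ f g xs)) (+-interchange (f x) (g x) _ _)

sumBy-mono-≤ : ∀ (f g : A → ℕ) xs → (∀ x → f x ≤ g x) → sumBy f xs ≤ sumBy g xs
sumBy-mono-≤ f g [] f≤g = z≤n
sumBy-mono-≤ f g (x ∷ xs) f≤g = +-mono-≤ (f≤g x) (sumBy-mono-≤ f g xs f≤g)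

sumBy-cong-∈ : ∀ (f g : A → ℕ) xs → (∀ x → x ∈ₗ xs → f x ≡ g x) → sumBy f xs ≡ sumBy g xs
sumBy-cong-∈ f g [] f≗g = refl
sumBy-cong-∈ f g (x ∷ xs) f≗g = cong₂ _+_ (f≗g x (here refl)) (sumBy-cong-∈ f g xs (λ y → f≗g y ∘ there))

sumBy-cong : ∀ (f g : A → ℕ) xs → (∀ x → f x ≡ g x) → sumBy f xs ≡ sumBy g xs
sumBy-cong f g xs f≗g = sumBy-cong-∈ f g xs (λ x _ → f≗g x)

sumBy-zero : ∀ (f : A → ℕ) xs → (∀ x → x ∈ₗ xs → f x ≡ 0) → sumBy f xs ≡ 0
sumBy-zero f [] _ = refl
sumBy-zero f (x ∷ xs) f≡0 rewrite f≡0 x (here refl) = sumBy-zero f xs (λ y → f≡0 y ∘ there)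

sumBy-++ : ∀ (f : A → ℕ) xs ys → sumBy f (xs ++ ys) ≡ sumBy f xs + sumBy f ys
sumBy-++ f xs ys = trans (cong sum (Listₚ.map-++ f xs ys)) (sum-++ (map f xs) (map f ys))

sumBy-map : ∀ (f : A → ℕ) (g : B → A) xs → sumBy f (map g xs) ≡ sumBy (f ∘ g) xs
sumBy-map f g xs = cong sum (sym (Listₚ.map-∘ xs))

sumBy-filter : ∀ {P : A → Set} (P? : Decidable P) (f : A → ℕ) xs →
  sumBy f (filter P? xs) ≡ sumBy (λ x → if does (P? x) then f x else 0) xs
sumBy-filter P? f [] = refl
sumBy-filter P? f (x ∷ xs) with does (P? x)
... | true = cong (f x +_) (sumBy-filter P? f xs)
... | false = sumBy-filter P? f xs

sumBy-comm : ∀ (g : B → A → ℕ) (ys : List B) xs →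
  sumBy (λ y → sumBy (g y) xs) ys ≡ sumBy (λ x → sumBy (λ y → g y x) ys) xs
sumBy-comm g ys [] = sumBy-zero (λ _ → 0) ys (λ _ _ → refl)
sumBy-comm g ys (x ∷ xs) =
  trans (sumBy-distrib-+ (λ y → g y x) (λ y → sumBy (g y) xs) ys)
        (cong (sumBy (λ y → g y x) ys +_) (sumBy-comm g ys xs))

sumBy-≤-tight : ∀ (f g : A → ℕ) xs → (∀ x → f x ≤ g x) → sumBy f xs ≡ sumBy g xs →
  ∀ x → x ∈ₗ xs → f x ≡ g x
sumBy-≤-tight f g (y ∷ ys) f≤g eq x x∈ with +-≤-tight (f≤g y) (sumBy-mono-≤ f g ys f≤g) eq | x∈
... | head , _    | here refl = head
... | _    , tail | there x∈ys = sumBy-≤-tight f g ys f≤g tail x x∈ys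

sumBy-delta : ∀ (f : A → ℕ) {x} xs → Unique xs → x ∈ₗ xs →
  (∀ y → y ≢ x → f y ≡ 0) → sumBy f xs ≡ f x
sumBy-delta f (y ∷ ys) (y∉ys ∷ _) (here refl) f≡0 =
  trans (cong (f y +_) (sumBy-zero f ys (λ z z∈ → f≡0 z (λ z≡y → All.lookup y∉ys z∈ (sym z≡y)))))
        (+-identityʳ (f y))
sumBy-delta f (y ∷ ys) (y∉ys ∷ uniq) (there x∈) f≡0 =
  trans (cong (_+ sumBy f ys) (f≡0 y (λ y≡x → All.lookup y∉ys x∈ y≡x)))
        (sumBy-delta f ys uniq x∈ f≡0)

sumBy-𝟙≟ : ∀ (_≟_ : DecidableEquality A) {x} xs → Unique xs → x ∈ₗ xs →
  sumBy (λ y → 𝟙 (does (y ≟ x))) xs ≡ 1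
sumBy-𝟙≟ _≟_ {x} xs uniq x∈ = trans
  (sumBy-delta _ xs uniq x∈ (λ y y≢x → cong 𝟙 (dec-false (y ≟ x) y≢x)))
  (cong 𝟙 (dec-true (x ≟ x) refl))

sumBy-≥-∈ : ∀ (f : A → ℕ) {x} xs → x ∈ₗ xs → f x ≤ sumBy f xs
sumBy-≥-∈ f (y ∷ ys) (here refl) = m≤m+n (f y) _
sumBy-≥-∈ f (y ∷ ys) (there x∈) = ≤-trans (sumBy-≥-∈ f ys x∈) (m≤n+m _ (f y))

sumBy-const-1 : ∀ (xs : List A) → sumBy (λ _ → 1) xs ≡ length xs
sumBy-const-1 [] = refl
sumBy-const-1 (_ ∷ xs) = cong suc (sumBy-const-1 xs)

first : A → List A → A
first x [] = x
first _ (y ∷ _) = y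

lastOf-∈ : ∀ (x : A) xs → lastOf x xs ∈ₗ x ∷ xs
lastOf-∈ x [] = here refl
lastOf-∈ x (y ∷ ys) = there (lastOf-∈ y ys)

lastOf-++ : ∀ (x : A) xs y ys → lastOf x (xs ++ y ∷ ys) ≡ lastOf y ys
lastOf-++ x [] y ys = refl
lastOf-++ x (z ∷ zs) y ys = lastOf-++ z zs y ys

linked-snoc : ∀ {R : A → A → Set} x xs {y} → Linked R (x ∷ xs) → R (lastOf x xs) y → Linked R (x ∷ xs ++ y ∷ [])
linked-snoc x [] _ R-last = R-last ∷ [-]
linked-snoc x (z ∷ zs) (R-xz ∷ linked) R-last = R-xz ∷ linked-snoc z zs linked R-last

Linked-lastOf : ∀ {R S : A → A → Set} → (∀ {a b} → R a b → S a b) → (∀ {a b c} → S a b → S b c → S a c) →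
  ∀ {x y r} → Linked R (x ∷ y ∷ r) → S x (lastOf y r)
Linked-lastOf R⇒S S-trans {y = y} {r} linked =
  All.lookup (AllPairs.head (Linked⇒AllPairs S-trans (Linkedₚ.map R⇒S linked))) (lastOf-∈ y r)

data NonBacktracking {A : Set} : List A → Set where
  one-step : ∀ {x y} → NonBacktracking (x ∷ y ∷ [])
  _∷_ : ∀ {x y z r} → x ≢ z → NonBacktracking (y ∷ z ∷ r) → NonBacktracking (x ∷ y ∷ z ∷ r)

nonBacktracking-++ : ∀ {v w} (a : A) r → Unique (a ∷ r) → All (v ≢_) (a ∷ r) → w ≢ lastOf a r →
  NonBacktracking (a ∷ r ++ v ∷ w ∷ [])
nonBacktracking-++ a [] _ _ w≢a = (w≢a ∘ sym) ∷ one-step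
nonBacktracking-++ a (b ∷ []) (_ ∷ unique) (v≢a ∷ v∉) w≢b =
  (v≢a ∘ sym) ∷ nonBacktracking-++ b [] unique v∉ w≢b
nonBacktracking-++ a (b ∷ c ∷ r) ((_ ∷ a≢c ∷ _) ∷ unique) (_ ∷ v∉) w≢last =
  a≢c ∷ nonBacktracking-++ b (c ∷ r) unique v∉ w≢last

close-cycle : ∀ {R : A → A → Set} {v w₁ w₂} ws →
  Linked R (v ∷ w₁ ∷ w₂ ∷ ws) → Unique (v ∷ w₁ ∷ w₂ ∷ ws) → R (lastOf w₂ ws) v →
  Linked R (v ∷ w₁ ∷ w₂ ∷ ws ++ v ∷ w₁ ∷ []) × NonBacktracking (v ∷ w₁ ∷ w₂ ∷ ws ++ v ∷ w₁ ∷ [])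
close-cycle {R = R} {v} {w₁} {w₂} ws linked@(v-w₁ ∷ _) ((v≢w₁ ∷ v≢w₂ ∷ v∉ws) ∷ unique@(w₁∉ ∷ _)) closing =
  subst (λ L → Linked R (v ∷ L)) (Listₚ.++-assoc (w₁ ∷ w₂ ∷ ws) (v ∷ []) (w₁ ∷ []))
    (linked-snoc v (w₁ ∷ w₂ ∷ ws ++ v ∷ []) (linked-snoc v (w₁ ∷ w₂ ∷ ws) linked closing)
      (subst (λ z → R z w₁) (sym (lastOf-++ v (w₁ ∷ w₂ ∷ ws) v [])) v-w₁)) ,
  v≢w₂ ∷ nonBacktracking-++ w₁ (w₂ ∷ ws) unique (v≢w₁ ∷ v≢w₂ ∷ v∉ws) (All.lookup w₁∉ (lastOf-∈ w₂ ws))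

module Walks {A : Set} (_≟_ : DecidableEquality A) (R : A → A → Set) where

  data Walk : A → A → Set where
    stop : ∀ {x} → Walk x x
    step : ∀ {x y z} → R x y → Walk y z → Walk x z

  inner : ∀ {x y} → Walk x y → List A
  inner stop = []
  inner (step {y = y} _ w) = y ∷ inner w

  vertices : ∀ {x y} → Walk x y → List A
  vertices {x} w = x ∷ inner w

  Simple : ∀ {x y} → Walk x y → Set
  Simple w = Unique (vertices w)

  linked : ∀ {x y} (w : Walk x y) → Linked R (vertices w)
  linked stop = [-]
  linked (step r w) = r ∷ linked w

  lastOf-inner : ∀ {x y} (w : Walk x y) → lastOf x (inner w) ≡ y
  lastOf-inner stop = refl
  lastOf-inner (step _ w) = lastOf-inner w

  fromLinked : ∀ x ys → Linked R (x ∷ ys) → Σ (Walk x (lastOf x ys)) λ w → inner w ≡ ys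
  fromLinked x [] _ = stop , refl
  fromLinked x (y ∷ ys) (r ∷ rs) with fromLinked y ys rs
  ... | w , inner≡ys = step r w , cong (y ∷_) inner≡ys

  inner-nonempty : ∀ {x y} (w : Walk x y) → x ≢ y → 1 ≤ length (inner w)
  inner-nonempty stop x≢x = ⊥-elim (x≢x refl)
  inner-nonempty (step _ _) _ = s≤s z≤n

  _++ʷ_ : ∀ {x y z} → Walk x y → Walk y z → Walk x z
  stop ++ʷ w = w
  step r v ++ʷ w = step r (v ++ʷ w)

  ∈-++ʷ⁻ : ∀ {x y z a} (v : Walk x y) (w : Walk y z) → a ∈ₗ vertices (v ++ʷ w) → a ∈ₗ vertices v ⊎ a ∈ₗ vertices w
  ∈-++ʷ⁻ stop w a∈ = inj₂ a∈
  ∈-++ʷ⁻ (step r v) w (here a≡x) = inj₁ (here a≡x)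
  ∈-++ʷ⁻ (step r v) w (there a∈) with ∈-++ʷ⁻ v w a∈
  ... | inj₁ a∈v = inj₁ (there a∈v)
  ... | inj₂ a∈w = inj₂ a∈w

  module _ (R-sym : ∀ {a b} → R a b → R b a) where

    reverse : ∀ {x y} → Walk x y → Walk y x
    reverse stop = stop
    reverse (step r w) = reverse w ++ʷ step (R-sym r) stop

    ∈-reverse⁻ : ∀ {x y a} (w : Walk x y) → a ∈ₗ vertices (reverse w) → a ∈ₗ vertices w
    ∈-reverse⁻ stop a∈ = a∈
    ∈-reverse⁻ (step r w) a∈ with ∈-++ʷ⁻ (reverse w) (step (R-sym r) stop) a∈
    ... | inj₁ a∈w = there (∈-reverse⁻ w a∈w)
    ... | inj₂ (here a≡y) = there (here a≡y)
    ... | inj₂ (there (here a≡x)) = here a≡x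

  SimpleWalkWithin : ∀ {x y} → Walk x y → A → A → Set
  SimpleWalkWithin w x′ y′ = Σ (Walk x′ y′) λ w′ → Simple w′ × (∀ {a} → a ∈ₗ vertices w′ → a ∈ₗ vertices w)

  suffixFrom : ∀ {x y a} (w : Walk x y) → Simple w → a ∈ₗ vertices w → SimpleWalkWithin w a y
  suffixFrom w simple (here refl) = w , simple , id
  suffixFrom (step r w) (_ ∷ simple) (there a∈) with suffixFrom w simple a∈
  ... | w′ , simple′ , ⊆w = w′ , simple′ , there ∘ ⊆w

  shortcut : ∀ {x y} (w : Walk x y) → SimpleWalkWithin w x y
  shortcut stop = stop , [] ∷ [] , id
  shortcut (step {x} r w) with shortcut w
  ... | w′ , simple′ , ⊆w with Any.any? (x ≟_) (vertices w′)
  ...   | yes x∈w′ with suffixFrom w′ simple′ x∈w′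
  ...     | w″ , simple″ , ⊆w′ = w″ , simple″ , there ∘ ⊆w ∘ ⊆w′
  shortcut (step {x} r w) | w′ , simple′ , ⊆w | no x∉w′ =
    step r w′ , ¬Any⇒All¬ (vertices w′) x∉w′ ∷ simple′ , λ { (here a≡x) → here a≡x ; (there a∈) → there (⊆w a∈) }

_≟ˢ_ : ∀ {n} → DecidableEquality (Subset n)
_≟ˢ_ = Vecₚ.≡-dec Boolₚ._≟_

∈-allSubsets : ∀ {n} (X : Subset n) → X ∈ₗ allSubsets n
∈-allSubsets [] = here refl
∈-allSubsets {suc n} (true ∷ X) = ∈-++⁺ˡ (∈-map⁺ (true ∷_) (∈-allSubsets X))
∈-allSubsets {suc n} (false ∷ X) = ∈-++⁺ʳ (map (true ∷_) (allSubsets n)) (∈-map⁺ (false ∷_) (∈-allSubsets X))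

allSubsets-unique : ∀ n → Unique (allSubsets n)
allSubsets-unique zero = [] ∷ []
allSubsets-unique (suc n) = Uniqueₚ.++⁺ (Uniqueₚ.map⁺ Vecₚ.∷-injectiveʳ (allSubsets-unique n))
  (Uniqueₚ.map⁺ Vecₚ.∷-injectiveʳ (allSubsets-unique n)) disjoint
  where
  disjoint : Disjoint (map (true ∷_) (allSubsets n)) (map (false ∷_) (allSubsets n))
  disjoint (∈true , ∈false) with ∈-map⁻ (true ∷_) ∈true | ∈-map⁻ (false ∷_) ∈false
  ... | _ , _ , refl | _ , _ , ()

∑ˢ : ∀ {n} → (Subset n → ℕ) → ℕ
∑ˢ {n} f = sumBy f (allSubsets n)

∑ˢ-split : ∀ {n} (f : Subset (suc n) → ℕ) → ∑ˢ f ≡ ∑ˢ (f ∘ (true ∷_)) + ∑ˢ (f ∘ (false ∷_))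
∑ˢ-split {n} f = trans (sumBy-++ f (map (true ∷_) (allSubsets n)) (map (false ∷_) (allSubsets n)))
  (cong₂ _+_ (sumBy-map f (true ∷_) (allSubsets n)) (sumBy-map f (false ∷_) (allSubsets n)))

∑ˢ-zero : ∀ n → ∑ˢ {n} (λ _ → 0) ≡ 0
∑ˢ-zero n = sumBy-zero {A = Subset n} (λ _ → 0) (allSubsets n) (λ _ _ → refl)

∑ˢ-delta : ∀ {n} (f : Subset n → ℕ) Y → (∀ X → X ≢ Y → f X ≡ 0) → ∑ˢ f ≡ f Y
∑ˢ-delta {n} f Y = sumBy-delta f (allSubsets n) (allSubsets-unique n) (∈-allSubsets Y)

∑ᶠ : ∀ {n} → (Fin n → ℕ) → ℕ
∑ᶠ {n} f = sumBy f (allFin n)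

∑ᶠ-suc : ∀ {n} (f : Fin (suc n) → ℕ) → ∑ᶠ f ≡ f zero + ∑ᶠ (f ∘ suc)
∑ᶠ-suc {n} f = cong (λ xs → f zero + sum xs)
  (trans (Listₚ.map-tabulate suc f) (sym (Listₚ.map-tabulate id (f ∘ suc))))

∑ᶠ-lookup : ∀ {n} (a : Vec ℕ n) → ∑ᶠ (lookup a) ≡ Vec.sum a
∑ᶠ-lookup [] = refl
∑ᶠ-lookup (x ∷ a) = trans (∑ᶠ-suc (lookup (x ∷ a))) (cong (x +_) (∑ᶠ-lookup a))

∑ᶠ-const-1 : ∀ n → ∑ᶠ {n} (λ _ → 1) ≡ n
∑ᶠ-const-1 n = trans (sumBy-const-1 (allFin n)) (Listₚ.length-tabulate id)

∑ᶠ-delta : ∀ {n} (f : Fin n → ℕ) j → (∀ i → i ≢ j → f i ≡ 0) → ∑ᶠ f ≡ f j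
∑ᶠ-delta {n} f j = sumBy-delta f (allFin n) (Uniqueₚ.allFin⁺ n) (∈-allFin j)

∑ᶠ-tabulate : ∀ {n} (f : Fin n → ℕ) → Vec.sum (Vec.tabulate f) ≡ ∑ᶠ f
∑ᶠ-tabulate {n} f = trans (sym (∑ᶠ-lookup (Vec.tabulate f))) (sumBy-cong _ f (allFin n) (Vecₚ.lookup∘tabulate f))

toggle-involutive : ∀ {n} (X : Subset n) i → toggle (toggle X i) i ≡ X
toggle-involutive X i = begin
  toggle (toggle X i) i                      ≡⟨ cong (λ b → toggle X i [ i ]≔ not b) (Vecₚ.lookup∘update i X _) ⟩
  toggle X i [ i ]≔ not (not (lookup X i))   ≡⟨ Vecₚ.[]≔-idempotent X i ⟩
  X [ i ]≔ not (not (lookup X i))            ≡⟨ cong (X [ i ]≔_) (Boolₚ.not-involutive (lookup X i)) ⟩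
  X [ i ]≔ lookup X i                        ≡⟨ Vecₚ.[]≔-lookup X i ⟩
  X                                          ∎
  where open ≡-Reasoning

lookup-toggle : ∀ {n} (X : Subset n) i → lookup (toggle X i) i ≡ not (lookup X i)
lookup-toggle X i = Vecₚ.lookup∘update i X _

toggle-injective : ∀ {n} (X : Subset n) {i j} → toggle X i ≡ toggle X j → i ≡ j
toggle-injective X {i} {j} eq with i Finₚ.≟ j
... | yes i≡j = i≡j
... | no i≢j = ⊥-elim (not≢ (lookup X i) (begin
  not (lookup X i)       ≡⟨ sym (lookup-toggle X i) ⟩
  lookup (toggle X i) i  ≡⟨ cong (λ Y → lookup Y i) eq ⟩
  lookup (toggle X j) i  ≡⟨ Vecₚ.lookup∘update′ i≢j X _ ⟩
  lookup X i             ∎))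
  where open ≡-Reasoning

toggle-≢ : ∀ {n} (X : Subset n) i → toggle X i ≢ X
toggle-≢ X i eq = not≢ (lookup X i) (trans (sym (lookup-toggle X i)) (cong (λ Y → lookup Y i) eq))

toggle-∉ : ∀ {n} (X : Subset n) {i} → lookup X i ≡ false → toggle X i ≡ X [ i ]≔ true
toggle-∉ X i∉X = cong (λ b → X [ _ ]≔ not b) i∉X

toggle-∈ : ∀ {n} (X : Subset n) {i} → lookup X i ≡ true → toggle X i ≡ remove X i
toggle-∈ X i∈X = cong (λ b → X [ _ ]≔ not b) i∈X

insert-∈ : ∀ {n} (X : Subset n) {i} → lookup X i ≡ true → X [ i ]≔ true ≡ X
insert-∈ X {i} i∈X = trans (cong (X [ i ]≔_) (sym i∈X)) (Vecₚ.[]≔-lookup X i)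

∣insert∣ : ∀ {n} (X : Subset n) i → lookup X i ≡ false → ∣ X [ i ]≔ true ∣ ≡ suc ∣ X ∣
∣insert∣ (false ∷ X) zero _ = refl
∣insert∣ (true ∷ X) (suc i) i∉X = cong suc (∣insert∣ X i i∉X)
∣insert∣ (false ∷ X) (suc i) i∉X = ∣insert∣ X i i∉X

∣remove∣ : ∀ {n} (X : Subset n) i → lookup X i ≡ true → ∣ X ∣ ≡ suc ∣ remove X i ∣
∣remove∣ (true ∷ X) zero _ = refl
∣remove∣ (true ∷ X) (suc i) i∈X = cong suc (∣remove∣ X i i∈X)
∣remove∣ (false ∷ X) (suc i) i∈X = ∣remove∣ X i i∈X

∣X∣≡0⇒X≡⊥ : ∀ {n} (X : Subset n) → ∣ X ∣ ≡ 0 → X ≡ ⊥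
∣X∣≡0⇒X≡⊥ [] _ = refl
∣X∣≡0⇒X≡⊥ (false ∷ X) eq = cong (false ∷_) (∣X∣≡0⇒X≡⊥ X eq)

∈⇒≢⊥ : ∀ {n} (X : Subset n) {i} → lookup X i ≡ true → X ≢ ⊥
∈⇒≢⊥ X {i} i∈X refl = true≢false (trans (sym i∈X) (Vecₚ.lookup-replicate i false))

∑ˢ-𝟙-⊆ : ∀ {n} (K : Subset n) → ∑ˢ (λ X → 𝟙 (does (X ⊆? K))) ≡ 2 ^ ∣ K ∣
∑ˢ-𝟙-⊆ [] = refl
∑ˢ-𝟙-⊆ {suc n} (true ∷ K) = trans (∑ˢ-split {n} _)
  (trans (cong₂ _+_ (∑ˢ-𝟙-⊆ K) (∑ˢ-𝟙-⊆ K)) (cong (2 ^ ∣ K ∣ +_) (sym (+-identityʳ _))))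
∑ˢ-𝟙-⊆ {suc n} (false ∷ K) = trans (∑ˢ-split {n} _) (cong₂ _+_ (∑ˢ-zero n) (∑ˢ-𝟙-⊆ K))

_≢⊥? : ∀ {n} (X : Subset n) → Dec (X ≢ ⊥)
X ≢⊥? = ¬? (X ≟ˢ ⊥)

∑ˢ-at-⊥ : ∀ {n} (g : Subset n → ℕ) → ∑ˢ (λ X → if does (X ≟ˢ ⊥) then g X else 0) ≡ g ⊥
∑ˢ-at-⊥ {n} g = trans
  (∑ˢ-delta _ ⊥
    (λ X X≢⊥ → cong (λ b → if b then g X else 0) (dec-false (X ≟ˢ ⊥) X≢⊥)))
  (cong (λ b → if b then g ⊥ else 0) (dec-true (⊥ {n} ≟ˢ ⊥) refl))

∑ˢ-nonempty : ∀ {n} (g : Subset n → ℕ) → ∑ˢ (λ X → if does (X ≢⊥?) then g X else 0) + g ⊥ ≡ ∑ˢ g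
∑ˢ-nonempty {n} g = begin
  ∑ˢ nonempty-part + g ⊥                  ≡⟨ cong (∑ˢ nonempty-part +_) (sym (∑ˢ-at-⊥ g)) ⟩
  ∑ˢ nonempty-part + ∑ˢ ⊥-part            ≡⟨ sym (sumBy-distrib-+ nonempty-part ⊥-part (allSubsets n)) ⟩
  ∑ˢ (λ X → nonempty-part X + ⊥-part X)   ≡⟨ sumBy-cong _ g (allSubsets n) (λ X → if-not+if (does (X ≟ˢ ⊥)) (g X)) ⟩
  ∑ˢ g                                    ∎
  where
  open ≡-Reasoning
  nonempty-part ⊥-part : Subset n → ℕ
  nonempty-part X = if does (X ≢⊥?) then g X else 0
  ⊥-part X = if does (X ≟ˢ ⊥) then g X else 0

∑ˢ-nonempty-⊆ : ∀ {n} (K : Subset n) →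
  ∑ˢ (λ X → if does (X ≢⊥?) then 𝟙 (does (X ⊆? K)) else 0) + 1 ≡ 2 ^ ∣ K ∣
∑ˢ-nonempty-⊆ {n} K = begin
  ∑ˢ nonempty-part + 1                   ≡⟨ cong (∑ˢ nonempty-part +_) (cong 𝟙 (sym (dec-true (⊥ ⊆? K) Subsetₚ.⊥⊆))) ⟩
  ∑ˢ nonempty-part + 𝟙 (does (⊥ ⊆? K))   ≡⟨ ∑ˢ-nonempty (λ X → 𝟙 (does (X ⊆? K))) ⟩
  ∑ˢ (λ X → 𝟙 (does (X ⊆? K)))           ≡⟨ ∑ˢ-𝟙-⊆ K ⟩
  2 ^ ∣ K ∣                              ∎
  where
  open ≡-Reasoning
  nonempty-part : Subset n → ℕ
  nonempty-part X = if does (X ≢⊥?) then 𝟙 (does (X ⊆? K)) else 0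

∑ˢ-nonempty-count : ∀ n → ∑ˢ {n} (λ X → 𝟙 (does (X ≢⊥?))) + 1 ≡ 2 ^ n
∑ˢ-nonempty-count n = begin
  ∑ˢ {n} (λ X → 𝟙 (does (X ≢⊥?))) + 1
    ≡⟨ cong (_+ 1) (sumBy-cong _ _ (allSubsets n) λ X →
         cong (λ b → if does (X ≢⊥?) then 𝟙 b else 0) (sym (dec-true (X ⊆? ⊤) Subsetₚ.⊆⊤))) ⟩
  ∑ˢ {n} (λ X → if does (X ≢⊥?) then 𝟙 (does (X ⊆? ⊤)) else 0) + 1
    ≡⟨ ∑ˢ-nonempty-⊆ (⊤ {n}) ⟩
  2 ^ ∣ ⊤ {n} ∣
    ≡⟨ cong (2 ^_) (Subsetₚ.∣⊤∣≡n n) ⟩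
  2 ^ n ∎
  where open ≡-Reasoning

∑ˢ-insert : ∀ {n} (i : Fin n) (h : Subset n → ℕ) →
  ∑ˢ (λ X → if lookup X i then 0 else h (X [ i ]≔ true)) ≡ ∑ˢ (λ X → if lookup X i then h X else 0)
∑ˢ-insert {suc n} zero h = begin
  ∑ˢ (λ X → if lookup X zero then 0 else h (X [ zero ]≔ true))  ≡⟨ ∑ˢ-split {n} _ ⟩
  ∑ˢ {n} (λ _ → 0) + ∑ˢ (λ X → h (true ∷ X))                    ≡⟨ +-comm (∑ˢ {n} (λ _ → 0)) _ ⟩
  ∑ˢ (λ X → h (true ∷ X)) + ∑ˢ {n} (λ _ → 0)                    ≡⟨ sym (∑ˢ-split {n} _) ⟩
  ∑ˢ (λ X → if lookup X zero then h X else 0)                    ∎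
  where open ≡-Reasoning
∑ˢ-insert {suc n} (suc i) h = trans (∑ˢ-split {n} _)
  (trans (cong₂ _+_ (∑ˢ-insert i (h ∘ (true ∷_))) (∑ˢ-insert i (h ∘ (false ∷_)))) (sym (∑ˢ-split {n} _)))

nonemptySubsets : ∀ n → List (Subset n)
nonemptySubsets n = filter _≢⊥? (allSubsets n)

∈-nonemptySubsets : ∀ {n} {Y : Subset n} → Y ≢ ⊥ → Y ∈ₗ nonemptySubsets n
∈-nonemptySubsets {Y = Y} Y≢⊥ = ∈-filter⁺ _≢⊥? (∈-allSubsets Y) Y≢⊥

nonemptySubsets-unique : ∀ n → Unique (nonemptySubsets n)
nonemptySubsets-unique n = Uniqueₚ.filter⁺ _≢⊥? (allSubsets-unique n)

sumOver-modular : ∀ {n} (K₁ K₂ : Subset n) (a : Vec ℕ n) →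
  sumOver (K₁ ∪ K₂) a + sumOver (K₁ ∩ K₂) a ≡ sumOver K₁ a + sumOver K₂ a
sumOver-modular [] [] [] = refl
sumOver-modular (p ∷ K₁) (q ∷ K₂) (x ∷ a) = begin
  (at (p ∨ q) + sumOver (K₁ ∪ K₂) a) + (at (p ∧ q) + sumOver (K₁ ∩ K₂) a)
    ≡⟨ +-interchange (at (p ∨ q)) _ (at (p ∧ q)) _ ⟩
  (at (p ∨ q) + at (p ∧ q)) + (sumOver (K₁ ∪ K₂) a + sumOver (K₁ ∩ K₂) a)
    ≡⟨ cong₂ _+_ (at-modular p q) (sumOver-modular K₁ K₂ a) ⟩
  (at p + at q) + (sumOver K₁ a + sumOver K₂ a)
    ≡⟨ +-interchange (at p) (at q) _ _ ⟩
  (at p + sumOver K₁ a) + (at q + sumOver K₂ a) ∎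
  where
  open ≡-Reasoning
  at : Bool → ℕ
  at b = if b then x else 0
  at-modular : ∀ p q → at (p ∨ q) + at (p ∧ q) ≡ at p + at q
  at-modular true true = refl
  at-modular true false = refl
  at-modular false true = +-comm x 0
  at-modular false false = refl

sumOver-⊥ : ∀ {n} (a : Vec ℕ n) → sumOver ⊥ a ≡ 0
sumOver-⊥ [] = refl
sumOver-⊥ (_ ∷ a) = sumOver-⊥ a

sumOver-⊤ : ∀ {n} (a : Vec ℕ n) → sumOver ⊤ a ≡ Vec.sum a
sumOver-⊤ [] = refl
sumOver-⊤ (x ∷ a) = cong (x +_) (sumOver-⊤ a)

sumOver-⁅⁆ : ∀ {n} (a : Vec ℕ n) i → sumOver ⁅ i ⁆ a ≡ lookup a i
sumOver-⁅⁆ (x ∷ a) zero = trans (cong (x +_) (sumOver-⊥ a)) (+-identityʳ x)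
sumOver-⁅⁆ (x ∷ a) (suc i) = sumOver-⁅⁆ a i

decrement : ∀ {n} → Vec ℕ n → Fin n → Vec ℕ n
decrement a i = a [ i ]≔ (lookup a i ∸ 1)

sumOver-decrement : ∀ {n} (K : Subset n) (a : Vec ℕ n) i → 1 ≤ lookup a i →
  sumOver K (decrement a i) + 𝟙 (lookup K i) ≡ sumOver K a
sumOver-decrement (true ∷ K) (suc m ∷ a) zero _ = +-comm (m + sumOver K a) 1
sumOver-decrement (false ∷ K) (x ∷ a) zero _ = +-identityʳ (sumOver K a)
sumOver-decrement (b ∷ K) (x ∷ a) (suc i) 1≤aᵢ =
  trans (+-assoc (if b then x else 0) _ _) (cong ((if b then x else 0) +_) (sumOver-decrement K a i 1≤aᵢ))

lookup-decrement : ∀ {n} (a : Vec ℕ n) i j → 1 ≤ lookup a i →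
  lookup (decrement a i) j + 𝟙 (does (i Finₚ.≟ j)) ≡ lookup a j
lookup-decrement a i j 1≤aᵢ with i Finₚ.≟ j
... | yes refl = trans (cong (_+ 1) (Vecₚ.lookup∘update i a _)) (m∸n+n≡m 1≤aᵢ)
... | no i≢j = trans (+-identityʳ _) (Vecₚ.lookup∘update′ (i≢j ∘ sym) a _)

∈-⋃⁺ : ∀ {n} {i : Fin n} {K} Ks → i ∈ K → K ∈ₗ Ks → i ∈ ⋃ Ks
∈-⋃⁺ (K ∷ Ks) i∈K (here refl) = Subsetₚ.x∈p∪q⁺ (inj₁ i∈K)
∈-⋃⁺ (_ ∷ Ks) i∈K (there K∈) = Subsetₚ.x∈p∪q⁺ (inj₂ (∈-⋃⁺ Ks i∈K K∈))

-- Spanning trees of Q_n have 2^n − 1 edges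

adj-sym : ∀ {n} {T : EdgeSet n} → IsEdgeSet T → ∀ {X Y} → Adj T X Y → Adj T Y X
adj-sym E {X} (i , refl , Tᵢ) = i , sym (toggle-involutive X i) , trans (sym (E X i)) Tᵢ

adj-≢ : ∀ {n} {T : EdgeSet n} {X Y} → Adj T X Y → Y ≢ X
adj-≢ {X = X} (i , refl , _) = toggle-≢ X i

module _ {n} {T : EdgeSet n} where

  path-tail : ∀ {X Z u us} → Path T X Z (u ∷ us) → Path T u Z us
  path-tail (_ ∷ linked , _ ∷ distinct , last) = linked , distinct , last

  path-start-∉ : ∀ {X Z ws} → Path T X Z ws → All (X ≢_) ws
  path-start-∉ (_ , X∉ ∷ _ , _) = X∉

  path-first-adj : ∀ {X Z u us} → Path T X Z (u ∷ us) → Adj T X u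
  path-first-adj (adj ∷ _ , _) = adj

  ¬closed-path : ∀ {Z u us} → ¬ Path T Z Z (u ∷ us)
  ¬closed-path {u = u} {us} (_ , Z∉ ∷ _ , last) = All.lookup Z∉ (lastOf-∈ u us) (sym last)

  first-step-edge : ∀ {X Z ws i} → Path T X Z ws → first X ws ≡ toggle X i → T X i ≡ true
  first-step-edge {X} {ws = []} {i} _ X≡toggle = ⊥-elim (toggle-≢ X i (sym X≡toggle))
  first-step-edge {X} ((j , refl , Tⱼ) ∷ _ , _) first≡ with toggle-injective X first≡
  ... | refl = Tⱼ

module HypercubeWalks {n} (T : EdgeSet n) where

  open Walks _≟ˢ_ (Adj T) public

  path→walk : ∀ {X Z ws} → Path T X Z ws → Σ (Walk X Z) λ w → inner w ≡ ws × Simple w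
  path→walk {X} {ws = ws} (linked , distinct , refl) with fromLinked X ws linked
  ... | w , inner≡ws = w , inner≡ws , subst (λ vs → Unique (X ∷ vs)) (sym inner≡ws) distinct

  walk→path : ∀ {X Z} (w : Walk X Z) → Simple w → Path T X Z (inner w)
  walk→path w simple = linked w , simple , lastOf-inner w

module Acyclic {n} (T : EdgeSet n) (E : IsEdgeSet T) (acyclic : ¬ HasCycle T) where

  open HypercubeWalks T

  next-unique : ∀ {X Z u us v vs} → Path T X Z (u ∷ us) → Path T X Z (v ∷ vs) → u ≡ v
  next-unique {X} {u = u} {v = v} p q with u ≟ˢ v
  ... | yes u≡v = u≡v
  ... | no u≢v = ⊥-elim (acyclic cycle)
    where
    wu = path→walk (path-tail p)
    wv = path→walk (path-tail q)
    loop = shortcut (proj₁ wu ++ʷ reverse (adj-sym E) (proj₁ wv))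
    w = proj₁ loop
    X∉w : ∀ {a} → a ∈ₗ vertices w → X ≢ a
    X∉w a∈ with ∈-++ʷ⁻ (proj₁ wu) (reverse (adj-sym E) (proj₁ wv)) (proj₂ (proj₂ loop) a∈)
    ... | inj₁ a∈u = All.lookup (path-start-∉ p) (subst (λ ws → _ ∈ₗ u ∷ ws) (proj₁ (proj₂ wu)) a∈u)
    ... | inj₂ a∈v = All.lookup (path-start-∉ q)
            (subst (λ ws → _ ∈ₗ v ∷ ws) (proj₁ (proj₂ wv)) (∈-reverse⁻ (adj-sym E) (proj₁ wv) a∈v))
    cycle : HasCycle T
    cycle = X , vertices w , s≤s (inner-nonempty w u≢v) , path-first-adj p ∷ linked w ,
            All.tabulate X∉w ∷ proj₁ (proj₂ loop) ,
            subst (λ y → Adj T y X) (sym (lastOf-inner w)) (adj-sym E (path-first-adj q))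

  ¬mutual-next : ∀ {X Y Z ws ws′} → Path T X Z ws → Path T Y Z ws′ → X ≢ Y →
    first X ws ≡ Y → first Y ws′ ≡ X → ⊥₀
  ¬mutual-next {ws = []} _ _ X≢Y X≡Y _ = X≢Y X≡Y
  ¬mutual-next {ws = _ ∷ _} {ws′ = []} _ _ X≢Y _ Y≡X = X≢Y (sym Y≡X)
  ¬mutual-next {ws = _ ∷ []} {ws′ = _ ∷ _} (_ , _ , refl) q _ refl refl = ¬closed-path q
  ¬mutual-next {ws = _ ∷ _ ∷ _} {ws′ = _ ∷ _} p q _ refl refl =
    All.lookup (path-start-∉ p) (there (here refl)) (sym (next-unique (path-tail p) q))

  next-across-edge : ∀ {X Y Z ws ws′} → Adj T X Y → Path T X Z ws → Path T Y Z ws′ →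
    first X ws ≡ Y ⊎ first Y ws′ ≡ X
  next-across-edge {Y = Y} {ws = ws} adj p q with Any.any? (Y ≟ˢ_) ws
  next-across-edge {X} {Y} {ws = a ∷ r} adj p q | yes Y∈ws
    with path→walk (path-tail p)
  ... | wa , inner≡r , simple with suffixFrom wa simple (subst (λ vs → Y ∈ₗ a ∷ vs) (sym inner≡r) Y∈ws)
  ...   | w , simple′ , ⊆wa = inj₁ (next-unique p via-Y)
    where
    via-Y : Path T X _ (Y ∷ inner w)
    via-Y = adj ∷ linked w ,
            All.tabulate (λ b∈ → All.lookup (path-start-∉ p) (subst (λ vs → _ ∈ₗ a ∷ vs) inner≡r (⊆wa b∈))) ∷ simple′ ,
            lastOf-inner w
  next-across-edge {X} {Y} {ws = ws} {ws′} adj p@(linked , distinct , last) q | no Y∉ws = via-X ws′ q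
    where
    from-Y : Path T Y _ (X ∷ ws)
    from-Y = adj-sym E adj ∷ linked , (adj-≢ {T = T} adj ∷ ¬Any⇒All¬ ws Y∉ws) ∷ distinct , last
    via-X : ∀ ws′ → Path T Y _ ws′ → first X ws ≡ Y ⊎ first Y ws′ ≡ X
    via-X [] (_ , _ , refl) = ⊥-elim (¬closed-path from-Y)
    via-X (_ ∷ _) q = inj₂ (next-unique q from-Y)

module SpanningTree {n} (T : EdgeSet n) (E : IsEdgeSet T)
  (connected : ∀ (X Y : Subset n) → ∃ λ ws → Path T X Y ws) (acyclic : ¬ HasCycle T) where

  open Acyclic T E acyclic

  rootPath : Subset n → List (Subset n)
  rootPath X = proj₁ (connected X ⊥)

  toRoot : ∀ X → Path T X ⊥ (rootPath X)
  toRoot X = proj₂ (connected X ⊥)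

  -- X owns the edge along which its path to ∅ leaves X: every edge of T has exactly one
  -- owner and every nonempty X owns exactly one edge, which counts the edges of T.
  owns : Subset n → Fin n → Bool
  owns X i = does (first X (rootPath X) ≟ˢ toggle X i)

  owns⇒first : ∀ X i → owns X i ≡ true → first X (rootPath X) ≡ toggle X i
  owns⇒first X i = does-true⇒ (first X (rootPath X) ≟ˢ toggle X i)

  owners-of-edge : ∀ X i → 𝟙 (owns X i) + 𝟙 (owns (toggle X i) i) ≡ 𝟙 (T X i)
  owners-of-edge X i = 𝟙-exactly-one
    (λ o → first-step-edge (toRoot X) (owns⇒first X i o))
    (λ o → trans (E X i) (first-step-edge (toRoot Y) (owns⇒first Y i o)))
    (λ Tᵢ → Data.Sum.map (dec-true (first X (rootPath X) ≟ˢ Y))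
                          (λ first≡X → dec-true (first Y (rootPath Y) ≟ˢ toggle Y i)
                                                (trans first≡X (sym (toggle-involutive X i))))
                          (next-across-edge (i , refl , Tᵢ) (toRoot X) (toRoot Y)))
    (λ oX oY → ¬mutual-next (toRoot X) (toRoot Y) (toggle-≢ X i ∘ sym) (owns⇒first X i oX)
                 (trans (owns⇒first Y i oY) (toggle-involutive X i)))
    where
    Y = toggle X i

  owned-count : ∀ {X ws} → Path T X ⊥ ws → ∑ᶠ (λ i → 𝟙 (does (first X ws ≟ˢ toggle X i))) ≡ 𝟙 (does (X ≢⊥?))
  owned-count {ws = []} (_ , _ , refl) = begin
    ∑ᶠ (λ i → 𝟙 (does (⊥ {n} ≟ˢ toggle ⊥ i)))
      ≡⟨ sumBy-zero _ (allFin n) (λ i _ → cong 𝟙 (dec-false (⊥ ≟ˢ toggle ⊥ i) (toggle-≢ ⊥ i ∘ sym))) ⟩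
    0
      ≡⟨ cong 𝟙 (sym (dec-false (⊥ {n} ≢⊥?) (λ ⊥≢⊥ → ⊥≢⊥ refl))) ⟩
    𝟙 (does (⊥ {n} ≢⊥?)) ∎
    where open ≡-Reasoning
  owned-count {X} {ws = _ ∷ _} path@((j , refl , _) ∷ _ , _) = begin
    ∑ᶠ (λ i → 𝟙 (does (toggle X j ≟ˢ toggle X i)))
      ≡⟨ ∑ᶠ-delta _ j (λ i i≢j → cong 𝟙 (dec-false (toggle X j ≟ˢ toggle X i) (i≢j ∘ sym ∘ toggle-injective X))) ⟩
    𝟙 (does (toggle X j ≟ˢ toggle X j))
      ≡⟨ cong 𝟙 (dec-true (toggle X j ≟ˢ toggle X j) refl) ⟩
    1
      ≡⟨ cong 𝟙 (sym (dec-true (X ≢⊥?) (λ { refl → ¬closed-path path }))) ⟩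
    𝟙 (does (X ≢⊥?)) ∎
    where open ≡-Reasoning

  dirCount-owns : ∀ i → dirCount T i ≡ ∑ˢ (λ X → 𝟙 (owns X i))
  dirCount-owns i = sym (begin
    ∑ˢ o
      ≡⟨ sumBy-cong _ _ (allSubsets n) (λ X → if-split (lookup X i) (o X)) ⟩
    ∑ˢ (λ X → (if lookup X i then o X else 0) + (if lookup X i then 0 else o X))
      ≡⟨ sumBy-distrib-+ (λ X → if lookup X i then o X else 0) (λ X → if lookup X i then 0 else o X) (allSubsets n) ⟩
    ∑ˢ (λ X → if lookup X i then o X else 0) + ∑ˢ (λ X → if lookup X i then 0 else o X)
      ≡⟨ cong (_+ ∑ˢ (λ X → if lookup X i then 0 else o X)) (sym (∑ˢ-insert i o)) ⟩
    ∑ˢ (λ X → if lookup X i then 0 else o (X [ i ]≔ true)) + ∑ˢ (λ X → if lookup X i then 0 else o X)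
      ≡⟨ sym (sumBy-distrib-+ (λ X → if lookup X i then 0 else o (X [ i ]≔ true))
                              (λ X → if lookup X i then 0 else o X) (allSubsets n)) ⟩
    ∑ˢ (λ X → (if lookup X i then 0 else o (X [ i ]≔ true)) + (if lookup X i then 0 else o X))
      ≡⟨ sumBy-cong _ _ (allSubsets n) edge-owners ⟩
    dirCount T i ∎)
    where
    open ≡-Reasoning
    o : Subset n → ℕ
    o X = 𝟙 (owns X i)
    edge-owners : ∀ X → (if lookup X i then 0 else o (X [ i ]≔ true)) + (if lookup X i then 0 else o X)
                        ≡ (if lookup X i then 0 else 𝟙 (T X i))
    edge-owners X = if-+ (lookup X i) λ i∉X →
      trans (+-comm (o (X [ i ]≔ true)) (o X))
            (trans (cong (λ Y → o X + 𝟙 (owns Y i)) (sym (toggle-∉ X i∉X))) (owners-of-edge X i))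

  sum-sig : Vec.sum (sig T) + 1 ≡ 2 ^ n
  sum-sig = begin
    Vec.sum (sig T) + 1
      ≡⟨ cong (_+ 1) (∑ᶠ-tabulate (dirCount T)) ⟩
    ∑ᶠ (dirCount T) + 1
      ≡⟨ cong (_+ 1) (sumBy-cong _ _ (allFin n) dirCount-owns) ⟩
    ∑ᶠ (λ i → ∑ˢ {n} (λ X → 𝟙 (owns X i))) + 1
      ≡⟨ cong (_+ 1) (sumBy-comm (λ i X → 𝟙 (owns X i)) (allFin n) (allSubsets n)) ⟩
    ∑ˢ {n} (λ X → ∑ᶠ (λ i → 𝟙 (owns X i))) + 1
      ≡⟨ cong (_+ 1) (sumBy-cong _ _ (allSubsets n) (λ X → owned-count (toRoot X))) ⟩
    ∑ˢ {n} (λ X → 𝟙 (does (X ≢⊥?))) + 1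
      ≡⟨ ∑ˢ-nonempty-count n ⟩
    2 ^ n ∎
    where open ≡-Reasoning

signature-sum : ∀ {n} {S : Vec ℕ n} → IsSignature S → Vec.sum S + 1 ≡ 2 ^ n
signature-sum (T , (E , connected , acyclic) , refl) = SpanningTree.sum-sig T E connected acyclic

-- Hall's theorem with capacities

load : ∀ {n} → (A → Fin n) → List A → Fin n → ℕ
load c L j = sumBy (λ v → 𝟙 (does (c v Finₚ.≟ j))) L

module Hall {A : Set} (_≟_ : DecidableEquality A) {n} (N : A → Subset n) where

  demand : List A → Subset n → ℕ
  demand L K = sumBy (λ v → 𝟙 (does (N v ⊆? K))) L

  HallCondition : List A → Vec ℕ n → Set
  HallCondition L a = ∀ K → demand L K ≤ sumOver K a

  demand-supermodular : ∀ L K₁ K₂ → demand L K₁ + demand L K₂ ≤ demand L (K₁ ∪ K₂) + demand L (K₁ ∩ K₂)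
  demand-supermodular L K₁ K₂ = begin
    demand L K₁ + demand L K₂
      ≡⟨ sym (sumBy-distrib-+ _ _ L) ⟩
    sumBy (λ v → 𝟙 (does (N v ⊆? K₁)) + 𝟙 (does (N v ⊆? K₂))) L
      ≤⟨ sumBy-mono-≤ _ _ L (λ v → pointwise (N v)) ⟩
    sumBy (λ v → 𝟙 (does (N v ⊆? K₁ ∪ K₂)) + 𝟙 (does (N v ⊆? K₁ ∩ K₂))) L
      ≡⟨ sumBy-distrib-+ _ _ L ⟩
    demand L (K₁ ∪ K₂) + demand L (K₁ ∩ K₂) ∎
    where
    open ≤-Reasoning
    pointwise : ∀ M → 𝟙 (does (M ⊆? K₁)) + 𝟙 (does (M ⊆? K₂)) ≤ 𝟙 (does (M ⊆? K₁ ∪ K₂)) + 𝟙 (does (M ⊆? K₁ ∩ K₂))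
    pointwise M with M ⊆? K₁ | M ⊆? K₂
    ... | yes M⊆K₁ | yes M⊆K₂
      rewrite dec-true (M ⊆? K₁ ∪ K₂) (Subsetₚ.⊆-trans M⊆K₁ (Subsetₚ.p⊆p∪q K₂))
            | dec-true (M ⊆? K₁ ∩ K₂) (λ i∈M → Subsetₚ.x∈p∩q⁺ (M⊆K₁ i∈M , M⊆K₂ i∈M)) = ≤-refl
    ... | yes M⊆K₁ | no _ rewrite dec-true (M ⊆? K₁ ∪ K₂) (Subsetₚ.⊆-trans M⊆K₁ (Subsetₚ.p⊆p∪q K₂)) = m≤m+n 1 _
    ... | no _ | yes M⊆K₂ rewrite dec-true (M ⊆? K₁ ∪ K₂) (Subsetₚ.⊆-trans M⊆K₂ (Subsetₚ.q⊆p∪q K₁ K₂)) = m≤m+n 1 _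
    ... | no _ | no _ = z≤n

  Tight : List A → Vec ℕ n → Subset n → Set
  Tight L a K = demand L K ≡ sumOver K a

  module _ (L : List A) (a : Vec ℕ n) (hall-L : HallCondition L a) where

    tight-⊥ : Tight L a ⊥
    tight-⊥ = trans (n≤0⇒n≡0 (≤-trans (hall-L ⊥) (≤-reflexive (sumOver-⊥ a)))) (sym (sumOver-⊥ a))

    tight-∪ : ∀ {K₁ K₂} → Tight L a K₁ → Tight L a K₂ → Tight L a (K₁ ∪ K₂)
    tight-∪ {K₁} {K₂} tight-K₁ tight-K₂ = ≤-antisym (hall-L (K₁ ∪ K₂)) (+-cancelʳ-≤ (demand L (K₁ ∩ K₂)) _ _ (begin
      sumOver (K₁ ∪ K₂) a + demand L (K₁ ∩ K₂)   ≤⟨ +-monoʳ-≤ (sumOver (K₁ ∪ K₂) a) (hall-L (K₁ ∩ K₂)) ⟩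
      sumOver (K₁ ∪ K₂) a + sumOver (K₁ ∩ K₂) a  ≡⟨ sumOver-modular K₁ K₂ a ⟩
      sumOver K₁ a + sumOver K₂ a                ≡⟨ sym (cong₂ _+_ tight-K₁ tight-K₂) ⟩
      demand L K₁ + demand L K₂                  ≤⟨ demand-supermodular L K₁ K₂ ⟩
      demand L (K₁ ∪ K₂) + demand L (K₁ ∩ K₂)    ∎))
      where open ≤-Reasoning

    tight-⋃ : ∀ Ks → All (Tight L a) Ks → Tight L a (⋃ Ks)
    tight-⋃ [] [] = tight-⊥
    tight-⋃ (K ∷ Ks) (tight-K ∷ tight-Ks) = tight-∪ tight-K (tight-⋃ Ks tight-Ks)

  SlackAt : List A → Vec ℕ n → Fin n → Subset n → Set
  SlackAt L a i K = demand L K + 𝟙 (lookup K i) ≤ sumOver K a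

  Slack : List A → Vec ℕ n → Fin n → Set
  Slack L a i = ∀ K → SlackAt L a i K

  slackAt? : ∀ L a i K → Dec (SlackAt L a i K)
  slackAt? L a i K = demand L K + 𝟙 (lookup K i) ≤? sumOver K a

  slack? : ∀ L a i → Dec (Slack L a i)
  slack? L a i = Dec.map′ (λ all K → All.lookup all (∈-allSubsets K)) (λ slack → All.tabulate (λ {K} _ → slack K))
    (All.all? (slackAt? L a i) (allSubsets n))

  ¬slack⇒tight : ∀ L a {i} (hall-L : HallCondition L a) → ¬ Slack L a i →
    Σ (Subset n) λ K → Tight L a K × i ∈ K
  ¬slack⇒tight L a {i} hall-L ¬slack with All.all? (slackAt? L a i) (allSubsets n)
  ... | yes all = ⊥-elim (¬slack (λ K → All.lookup all (∈-allSubsets K)))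
  ... | no ¬all with Any.satisfied (¬All⇒Any¬ (slackAt? L a i) (allSubsets n) ¬all)
  ...   | K , ¬slack-K with lookup K i in i∈K
  ...     | false = ⊥-elim (¬slack-K (≤-trans (≤-reflexive (+-identityʳ _)) (hall-L K)))
  ...     | true = K , ≤-antisym (hall-L K) (≮⇒≥ (¬slack-K ∘ ≤-trans (≤-reflexive (+-comm _ 1)))) , Vecₚ.lookup⇒[]= i K i∈K

  -- If no i ∈ N v had slack, each i ∈ N v would lie in a tight set; the union U of these
  -- is tight by supermodularity of the demand, and N v ⊆ U breaks the condition for v ∷ L.
  slack-exists : ∀ v L a → HallCondition (v ∷ L) a → ∃ λ i → i ∈ N v × Slack L a i
  slack-exists v L a hall-vL with Finₚ.any? (λ i → (i ∈? N v) ×-dec slack? L a i)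
  ... | yes (i , i∈Nv , slack) = i , i∈Nv , slack
  ... | no ¬slack = ⊥-elim (1+n≰n (begin
    1 + demand L U                      ≡⟨ cong (λ b → 𝟙 b + demand L U) (sym (dec-true (N v ⊆? U) Nv⊆U)) ⟩
    demand (v ∷ L) U                    ≤⟨ hall-vL U ⟩
    sumOver U a                         ≡⟨ sym (tight-⋃ L a hall-L Ks (All.tabulate λ K∈ → tight-member K∈)) ⟩
    demand L U                          ∎))
    where
    open ≤-Reasoning
    hall-L : HallCondition L a
    hall-L K = ≤-trans (m≤n+m (demand L K) _) (hall-vL K)
    around : ∀ i → Σ (Subset n) λ K → Tight L a K × (i ∈ N v → i ∈ K)
    around i with i ∈? N v
    ... | yes i∈Nv with ¬slack⇒tight L a hall-L (λ slack → ¬slack (i , i∈Nv , slack))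
    ...   | K , tight , i∈K = K , tight , λ _ → i∈K
    around i | no i∉Nv = ⊥ , tight-⊥ L a hall-L , λ i∈Nv → ⊥-elim (i∉Nv i∈Nv)
    Ks = map (proj₁ ∘ around) (allFin n)
    U = ⋃ Ks
    tight-member : ∀ {K} → K ∈ₗ Ks → Tight L a K
    tight-member K∈ with ∈-map⁻ (proj₁ ∘ around) K∈
    ... | i , _ , refl = proj₁ (proj₂ (around i))
    Nv⊆U : N v ⊆ U
    Nv⊆U {i} i∈Nv = ∈-⋃⁺ Ks (proj₂ (proj₂ (around i)) i∈Nv) (∈-map⁺ (proj₁ ∘ around) (∈-allFin i))

  slack⇒positive : ∀ L a {i} → Slack L a i → 1 ≤ lookup a i
  slack⇒positive L a {i} slack = begin
    1                                    ≡⟨ cong 𝟙 (sym (Vecₚ.[]=⇒lookup (Subsetₚ.x∈⁅x⁆ i))) ⟩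
    𝟙 (lookup ⁅ i ⁆ i)                   ≤⟨ m≤n+m _ (demand L ⁅ i ⁆) ⟩
    demand L ⁅ i ⁆ + 𝟙 (lookup ⁅ i ⁆ i)  ≤⟨ slack ⁅ i ⁆ ⟩
    sumOver ⁅ i ⁆ a                      ≡⟨ sumOver-⁅⁆ a i ⟩
    lookup a i                           ∎
    where open ≤-Reasoning

  slack⇒hall : ∀ L a {i} → Slack L a i → HallCondition L (decrement a i)
  slack⇒hall L a {i} slack K = +-cancelʳ-≤ (𝟙 (lookup K i)) _ _
    (≤-trans (slack K) (≤-reflexive (sym (sumOver-decrement K a i (slack⇒positive L a slack)))))

  extend : A → Fin n → (A → Fin n) → A → Fin n
  extend v i c u = if does (u ≟ v) then i else c u

  extend-≢ : ∀ {v u} i c → u ≢ v → extend v i c u ≡ c u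
  extend-≢ {v} {u} i c u≢v = cong (λ b → if b then i else c u) (dec-false (u ≟ v) u≢v)

  extend-≡ : ∀ v i c → extend v i c v ≡ i
  extend-≡ v i c = cong (λ b → if b then i else c v) (dec-true (v ≟ v) refl)

  load-extend : ∀ {v} i c L → All (v ≢_) L → ∀ j →
    load (extend v i c) (v ∷ L) j ≡ 𝟙 (does (i Finₚ.≟ j)) + load c L j
  load-extend {v} i c L v∉L j = cong₂ _+_
    (cong (λ k → 𝟙 (does (k Finₚ.≟ j))) (extend-≡ v i c))
    (sumBy-cong-∈ _ _ L (λ u u∈L →
      cong (λ k → 𝟙 (does (k Finₚ.≟ j))) (extend-≢ i c (λ u≡v → All.lookup v∉L u∈L (sym u≡v)))))

  hall : ∀ (default : Fin n) L → Unique L → ∀ a → HallCondition L a →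
    Σ (A → Fin n) λ c → (∀ v → v ∈ₗ L → c v ∈ N v) × (∀ j → load c L j ≤ lookup a j)
  hall default [] _ a _ = (λ _ → default) , (λ _ ()) , (λ _ → z≤n)
  hall default (v ∷ L) (v∉L ∷ unique) a hall-vL with slack-exists v L a hall-vL
  ... | i , i∈Nv , slack with hall default L unique (decrement a i) (slack⇒hall L a slack)
  ...   | c , c∈N , load-c≤ = extend v i c , extend∈N , load≤
    where
    extend∈N : ∀ u → u ∈ₗ v ∷ L → extend v i c u ∈ N u
    extend∈N u (here refl) = subst (_∈ N v) (sym (extend-≡ v i c)) i∈Nv
    extend∈N u (there u∈L) = subst (_∈ N u) (sym (extend-≢ i c (λ u≡v → All.lookup v∉L u∈L (sym u≡v)))) (c∈N u u∈L)
    load≤ : ∀ j → load (extend v i c) (v ∷ L) j ≤ lookup a j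
    load≤ j = begin
      load (extend v i c) (v ∷ L) j                        ≡⟨ load-extend i c L v∉L j ⟩
      𝟙 (does (i Finₚ.≟ j)) + load c L j                    ≤⟨ +-monoʳ-≤ (𝟙 (does (i Finₚ.≟ j))) (load-c≤ j) ⟩
      𝟙 (does (i Finₚ.≟ j)) + lookup (decrement a i) j      ≡⟨ +-comm _ (lookup (decrement a i) j) ⟩
      lookup (decrement a i) j + 𝟙 (does (i Finₚ.≟ j))      ≡⟨ lookup-decrement a i j (slack⇒positive L a slack) ⟩
      lookup a j                                            ∎
      where open ≤-Reasoning

total-load : ∀ {n} (c : Subset n → Fin n) → ∑ᶠ (load c (nonemptySubsets n)) ≡ ∑ˢ {n} (λ Y → 𝟙 (does (Y ≢⊥?)))
total-load {n} c = begin
  ∑ᶠ (λ j → sumBy (λ v → 𝟙 (does (c v Finₚ.≟ j))) (nonemptySubsets n))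
    ≡⟨ sumBy-comm (λ j v → 𝟙 (does (c v Finₚ.≟ j))) (allFin n) (nonemptySubsets n) ⟩
  sumBy (λ v → ∑ᶠ (λ j → 𝟙 (does (c v Finₚ.≟ j)))) (nonemptySubsets n)
    ≡⟨ sumBy-cong _ _ (nonemptySubsets n) (λ v → trans
         (∑ᶠ-delta _ (c v) (λ j j≢cv → cong 𝟙 (dec-false (c v Finₚ.≟ j) (j≢cv ∘ sym))))
         (cong 𝟙 (dec-true (c v Finₚ.≟ c v) refl))) ⟩
  sumBy (λ _ → 1) (nonemptySubsets n)
    ≡⟨ sumBy-filter _≢⊥? (λ _ → 1) (allSubsets n) ⟩
  ∑ˢ {n} (λ Y → 𝟙 (does (Y ≢⊥?))) ∎
  where open ≡-Reasoning

nonempty-count≡sum : ∀ {n} (S : Vec ℕ n) → Vec.sum S + 1 ≡ 2 ^ n → ∑ˢ {n} (λ Y → 𝟙 (does (Y ≢⊥?))) ≡ Vec.sum S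
nonempty-count≡sum {n} S sum-S = +-cancelʳ-≡ 1 _ _ (trans (∑ˢ-nonempty-count n) (sym sum-S))

load-exact : ∀ {n} (c : Subset n → Fin n) (S : Vec ℕ n) → Vec.sum S + 1 ≡ 2 ^ n →
  (∀ j → load c (nonemptySubsets n) j ≤ lookup S j) → ∀ j → load c (nonemptySubsets n) j ≡ lookup S j
load-exact {n} c S sum-S load≤ j = sumBy-≤-tight (load c (nonemptySubsets n)) (lookup S) (allFin n) load≤
  (trans (total-load c) (trans (nonempty-count≡sum S sum-S) (sym (∑ᶠ-lookup S)))) j (∈-allFin j)

-- Parent trees

-- The edge between X and X ∪ {i} is present iff c picks i as the direction in which
-- X ∪ {i} descends to its parent.
parentTree : ∀ {n} → (Subset n → Fin n) → EdgeSet n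
parentTree c X i = does (c (X [ i ]≔ true) Finₚ.≟ i)

Up : ∀ {n} → Subset n → Subset n → Set
Up X Y = ∣ Y ∣ ≡ suc ∣ X ∣

up-asym : ∀ {n} (X Y : Subset n) → Up X Y → Up Y X → ⊥₀
up-asym X Y X<Y Y<X = 1+n≰n (≤-trans (n≤1+n (suc ∣ X ∣)) (≤-reflexive (sym (trans Y<X (cong suc X<Y)))))

toggle-up : ∀ {n} (X : Subset n) {i} → lookup X i ≡ false → Up X (toggle X i)
toggle-up X {i} i∉X = trans (cong ∣_∣ (toggle-∉ X i∉X)) (∣insert∣ X i i∉X)

toggle-down : ∀ {n} (X : Subset n) {i} → lookup X i ≡ true → Up (toggle X i) X
toggle-down X {i} i∈X = trans (∣remove∣ X i i∈X) (cong (suc ∘ ∣_∣) (sym (toggle-∈ X i∈X)))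

up⇒∉ : ∀ {n} (X : Subset n) i b → lookup X i ≡ b → Up X (toggle X i) → lookup X i ≡ false
up⇒∉ X i false i∉X _ = i∉X
up⇒∉ X i true i∈X up = ⊥-elim (up-asym X (toggle X i) up (toggle-down X i∈X))

down⇒∈ : ∀ {n} (X : Subset n) i b → lookup X i ≡ b → Up (toggle X i) X → lookup X i ≡ true
down⇒∈ X i true i∈X _ = i∈X
down⇒∈ X i false i∉X down = ⊥-elim (up-asym (toggle X i) X down (toggle-up X i∉X))

adj-up-or-down : ∀ {n} {T : EdgeSet n} {X Y} → Adj T X Y → Up X Y ⊎ Up Y X
adj-up-or-down {X = X} (i , refl , _) = by-membership (lookup X i) refl
  where
  by-membership : ∀ b → lookup X i ≡ b → Up X (toggle X i) ⊎ Up (toggle X i) X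
  by-membership false i∉X = inj₁ (toggle-up X i∉X)
  by-membership true i∈X = inj₂ (toggle-down X i∈X)

module ParentTree {n} (c : Subset n → Fin n) (c∈ : ∀ X → X ≢ ⊥ → lookup X (c X) ≡ true) where

  T : EdgeSet n
  T = parentTree c

  open HypercubeWalks T

  isEdgeSet : IsEdgeSet T
  isEdgeSet X i = cong (λ Y → does (c Y Finₚ.≟ i)) (sym (Vecₚ.[]≔-idempotent X i))

  to-parent : ∀ X → X ≢ ⊥ → Adj T X (remove X (c X))
  to-parent X X≢⊥ = c X , sym (toggle-∈ X cX∈X) , dec-true (c (X [ c X ]≔ true) Finₚ.≟ c X) (cong c (insert-∈ X cX∈X))
    where cX∈X = c∈ X X≢⊥

  Descent : ℕ → Subset n → Set
  Descent k X = Σ (Walk X ⊥) λ w → Simple w × length (inner w) ≡ k × All (λ Z → ∣ Z ∣ ≤ k) (vertices w)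

  descent-step : ∀ {k X} (X≢⊥ : X ≢ ⊥) → ∣ X ∣ ≡ suc k → Descent k (remove X (c X)) → Descent (suc k) X
  descent-step {X = X} X≢⊥ ∣X∣≡1+k d =
    step (to-parent X X≢⊥) (proj₁ d) ,
    All.map (λ ∣Z∣≤k X≡Z → 1+n≰n (≤-trans (≤-reflexive (trans (sym ∣X∣≡1+k) (cong ∣_∣ X≡Z))) ∣Z∣≤k)) small ∷ proj₁ (proj₂ d) ,
    cong suc (proj₁ (proj₂ (proj₂ d))) ,
    ≤-reflexive ∣X∣≡1+k ∷ All.map m≤n⇒m≤1+n small
    where small = proj₂ (proj₂ (proj₂ d))

  descent : ∀ k X → ∣ X ∣ ≡ k → Descent k X
  descent zero X ∣X∣≡0 with ∣X∣≡0⇒X≡⊥ X ∣X∣≡0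
  ... | refl = stop , [] ∷ [] , refl , ≤-reflexive ∣X∣≡0 ∷ []
  descent (suc k) X ∣X∣≡1+k = descent-step X≢⊥ ∣X∣≡1+k (descent k (remove X (c X)) ∣parent∣≡k)
    where
    X≢⊥ : X ≢ ⊥
    X≢⊥ refl = 0≢1+n (trans (sym (Subsetₚ.∣⊥∣≡0 n)) ∣X∣≡1+k)
    ∣parent∣≡k : ∣ remove X (c X) ∣ ≡ k
    ∣parent∣≡k = suc-injective (trans (sym (∣remove∣ X (c X) (c∈ X X≢⊥))) ∣X∣≡1+k)

  upright : Upright T
  upright X with descent ∣ X ∣ X refl
  ... | w , simple , length≡ , _ = inner w , walk→path w simple , length≡

  connected : ∀ X Y → ∃ λ ws → Path T X Y ws
  connected X Y with shortcut (proj₁ (descent ∣ X ∣ X refl) ++ʷ reverse (adj-sym isEdgeSet) (proj₁ (descent ∣ Y ∣ Y refl)))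
  ... | w , simple , _ = inner w , walk→path w simple

  ψ : ∀ X {x} → lookup X x ≡ true → c X ≡ x → PsiIs T X x
  ψ X x∈X refl = inner (proj₁ d) , walk→path (proj₁ d′) (proj₁ (proj₂ d′))
    where
    X≢⊥ = ∈⇒≢⊥ X x∈X
    d = descent _ (remove X (c X)) refl
    d′ = descent-step X≢⊥ (∣remove∣ X (c X) (c∈ X X≢⊥)) d

  lower-neighbour-unique : ∀ {X Y Z} → Adj T X Y → Adj T Y Z → Up X Y → Up Z Y → X ≡ Z
  lower-neighbour-unique {X} (i , refl , Tᵢ) (j , refl , Tⱼ) X<Y Z<Y =
    trans (sym (toggle-involutive X i)) (cong (toggle (toggle X i)) (trans (sym cY≡i) cY≡j))
    where
    i∉X = up⇒∉ X i (lookup X i) refl X<Y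
    j∈Y = down⇒∈ (toggle X i) j _ refl Z<Y
    cY≡i : c (toggle X i) ≡ i
    cY≡i = trans (cong c (toggle-∉ X i∉X)) (does-true⇒ (c (X [ i ]≔ true) Finₚ.≟ i) Tᵢ)
    cY≡j : c (toggle X i) ≡ j
    cY≡j = trans (cong c (sym (insert-∈ (toggle X i) j∈Y))) (does-true⇒ (c (toggle X i [ j ]≔ true) Finₚ.≟ j) Tⱼ)

  climbs : ∀ x y r → Linked (Adj T) (x ∷ y ∷ r) → NonBacktracking (x ∷ y ∷ r) → Up x y → Linked Up (x ∷ y ∷ r)
  climbs x y [] _ _ x<y = x<y ∷ [-]
  climbs x y (z ∷ r) (x-y ∷ y-z ∷ linked) (x≢z ∷ nb) x<y with adj-up-or-down {T = T} y-z
  ... | inj₁ y<z = x<y ∷ climbs y z r (y-z ∷ linked) nb y<z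
  ... | inj₂ z<y = ⊥-elim (x≢z (lower-neighbour-unique x-y y-z x<y z<y))

  LastStepDown : Subset n → Subset n → List (Subset n) → Set
  LastStepDown x y [] = Up y x
  LastStepDown x y (z ∷ r) = LastStepDown y z r

  ¬climb-down : ∀ x y r → Linked Up (x ∷ y ∷ r) → LastStepDown x y r → ⊥₀
  ¬climb-down x y [] (x<y ∷ _) y<x = up-asym x y x<y y<x
  ¬climb-down x y (z ∷ r) (_ ∷ climb) down = ¬climb-down y z r climb down

  descends : ∀ x y r → Linked (Adj T) (x ∷ y ∷ r) → NonBacktracking (x ∷ y ∷ r) → LastStepDown x y r →
    Linked (λ a b → Up b a) (x ∷ y ∷ r)
  descends x y r linked@(x-y ∷ _) nb down with adj-up-or-down {T = T} x-y
  ... | inj₁ x<y = ⊥-elim (¬climb-down x y r (climbs x y r linked nb x<y) down)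
  descends x y [] _ _ _ | inj₂ y<x = y<x ∷ [-]
  descends x y (z ∷ r) (_ ∷ linked) (_ ∷ nb) down | inj₂ y<x = y<x ∷ descends y z r linked nb down

  lastStepDown-++ : ∀ {a b} x y ys → Up b a → LastStepDown x y (ys ++ a ∷ b ∷ [])
  lastStepDown-++ x y [] b<a = b<a
  lastStepDown-++ x y (z ∷ zs) b<a = lastStepDown-++ y z zs b<a

  -- Closed up into a non-backtracking walk, a cycle would be monotone in size, since a step
  -- up followed by a step down returns to where it started (lower-neighbour-unique).
  acyclic : ¬ HasCycle T
  acyclic (_ , [] , () , _)
  acyclic (_ , _ ∷ [] , s≤s () , _)
  acyclic (v , w₁ ∷ w₂ ∷ ws , _ , linked@(v-w₁ ∷ _) , distinct , closing)
    with close-cycle ws linked distinct closing | adj-up-or-down {T = T} v-w₁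
  ... | closed , nonBacktracking | inj₁ v<w₁ = <-irrefl (cong ∣_∣ (sym (lastOf-++ w₂ ws v (w₁ ∷ []))))
    (Linked-lastOf (≤-reflexive ∘ sym) <-trans
      (Linkedₚ.tail (climbs v w₁ (w₂ ∷ ws ++ v ∷ w₁ ∷ []) closed nonBacktracking v<w₁)))
  ... | closed , nonBacktracking | inj₂ w₁<v = <-irrefl (cong ∣_∣ (lastOf-++ w₂ ws v (w₁ ∷ [])))
    (Linked-lastOf (≤-reflexive ∘ sym) (λ b<a c<b → <-trans c<b b<a)
      (Linkedₚ.tail (descends v w₁ (w₂ ∷ ws ++ v ∷ w₁ ∷ []) closed nonBacktracking (lastStepDown-++ v w₁ (w₂ ∷ ws) w₁<v))))

  dirCount-parentTree : ∀ i → dirCount T i ≡ load c (nonemptySubsets n) i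
  dirCount-parentTree i = trans (∑ˢ-insert i h)
    (trans (sumBy-cong _ _ (allSubsets n) pointwise) (sym (sumBy-filter _≢⊥? h (allSubsets n))))
    where
    h : Subset n → ℕ
    h Y = 𝟙 (does (c Y Finₚ.≟ i))
    pointwise : ∀ Y → (if lookup Y i then h Y else 0) ≡ (if does (Y ≢⊥?) then h Y else 0)
    pointwise Y = by-membership (lookup Y i) refl
      where
      by-membership : ∀ b → lookup Y i ≡ b → (if b then h Y else 0) ≡ (if does (Y ≢⊥?) then h Y else 0)
      by-membership true i∈Y = cong (λ b → if b then h Y else 0) (sym (dec-true (Y ≢⊥?) (∈⇒≢⊥ Y i∈Y)))
      by-membership false i∉Y with Y ≟ˢ ⊥
      ... | yes _ = refl
      ... | no Y≢⊥ = sym (cong 𝟙 (dec-false (c Y Finₚ.≟ i)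
                        (λ cY≡i → true≢false (trans (sym (c∈ Y Y≢⊥)) (trans (cong (lookup Y) cY≡i) i∉Y)))))

-- Prescribed parents

module Prescribed {n ℓ} (X : Fin ℓ → Subset n) (X-injective : ∀ s t → X s ≡ X t → s ≡ t)
                  (x : Fin ℓ → Fin n) (x∈X : ∀ t → x t ∈ X t) where

  prescribed? : ∀ Y → Dec (∃ λ t → Y ≡ X t)
  prescribed? Y = Finₚ.any? (λ t → Y ≟ˢ X t)

  allowedBy : ∀ Y → Dec (∃ λ t → Y ≡ X t) → Subset n
  allowedBy Y (yes (t , _)) = ⁅ x t ⁆
  allowedBy Y (no _) = Y

  allowed : Subset n → Subset n
  allowed Y = allowedBy Y (prescribed? Y)

  allowed-⊆ : ∀ Y → allowed Y ⊆ Y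
  allowed-⊆ Y = by (prescribed? Y)
    where
    by : ∀ p? → allowedBy Y p? ⊆ Y
    by (yes (t , refl)) i∈ = subst (_∈ X t) (sym (Subsetₚ.x∈⁅y⁆⇒x≡y (x t) i∈)) (x∈X t)
    by (no _) i∈ = i∈

  allowed-⊈⊥ : ∀ Y → Y ≢ ⊥ → ¬ (allowed Y ⊆ ⊥)
  allowed-⊈⊥ Y Y≢⊥ = by (prescribed? Y)
    where
    by : ∀ p? → ¬ (allowedBy Y p? ⊆ ⊥)
    by (yes (t , _)) ⊆⊥ = Subsetₚ.∉⊥ (⊆⊥ (Subsetₚ.x∈⁅x⁆ (x t)))
    by (no _) ⊆⊥ = Y≢⊥ (Subsetₚ.⊆-antisym ⊆⊥ Subsetₚ.⊥⊆)

  allowed-prescribed : ∀ t → allowed (X t) ≡ ⁅ x t ⁆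
  allowed-prescribed t = by (prescribed? (X t))
    where
    by : ∀ p? → allowedBy (X t) p? ≡ ⁅ x t ⁆
    by (yes (s , Xt≡Xs)) = cong (⁅_⁆ ∘ x) (X-injective s t (sym Xt≡Xs))
    by (no ¬prescribed) = ⊥-elim (¬prescribed (t , refl))

  allowed-⊆-bound : ∀ Y K → 𝟙 (does (allowed Y ⊆? K)) ≤ 𝟙 (does (Y ⊆? K)) + 𝟙 (does (prescribed? Y))
  allowed-⊆-bound Y K with prescribed? Y
  ... | yes _ = ≤-trans (𝟙≤1 _) (m≤n+m 1 _)
  ... | no _ = ≤-reflexive (sym (+-identityʳ _))

  prescribed-count : ∑ˢ (λ Y → 𝟙 (does (prescribed? Y))) ≤ ℓ
  prescribed-count = begin
    ∑ˢ (λ Y → 𝟙 (does (prescribed? Y)))         ≤⟨ sumBy-mono-≤ _ _ (allSubsets n) at-most-once ⟩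
    ∑ˢ (λ Y → ∑ᶠ (λ t → 𝟙 (does (Y ≟ˢ X t))))   ≡⟨ sumBy-comm (λ Y t → 𝟙 (does (Y ≟ˢ X t))) (allSubsets n) (allFin ℓ) ⟩
    ∑ᶠ (λ t → ∑ˢ (λ Y → 𝟙 (does (Y ≟ˢ X t))))   ≡⟨ sumBy-cong _ _ (allFin ℓ) (λ t →
                                                     sumBy-𝟙≟ _≟ˢ_ (allSubsets n) (allSubsets-unique n) (∈-allSubsets (X t))) ⟩
    ∑ᶠ {ℓ} (λ _ → 1)                             ≡⟨ ∑ᶠ-const-1 ℓ ⟩
    ℓ                                            ∎
    where
    open ≤-Reasoning
    at-most-once : ∀ Y → 𝟙 (does (prescribed? Y)) ≤ ∑ᶠ (λ t → 𝟙 (does (Y ≟ˢ X t)))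
    at-most-once Y with prescribed? Y
    ... | no _ = z≤n
    ... | yes (t , Y≡Xt) = ≤-trans (≤-reflexive (cong 𝟙 (sym (dec-true (Y ≟ˢ X t) Y≡Xt))))
                                   (sumBy-≥-∈ _ (allFin ℓ) (∈-allFin t))

  open Hall _≟ˢ_ allowed public

  demand-nonempty : ∀ K →
    demand (nonemptySubsets n) K ≡ ∑ˢ (λ Y → if does (Y ≢⊥?) then 𝟙 (does (allowed Y ⊆? K)) else 0)
  demand-nonempty K = sumBy-filter _≢⊥? _ (allSubsets n)

  demand-⊥ : demand (nonemptySubsets n) ⊥ ≡ 0
  demand-⊥ = trans (demand-nonempty ⊥) (sumBy-zero _ (allSubsets n) (λ Y _ → nothing-below Y))
    where
    nothing-below : ∀ Y → (if does (Y ≢⊥?) then 𝟙 (does (allowed Y ⊆? ⊥)) else 0) ≡ 0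
    nothing-below Y with Y ≟ˢ ⊥
    ... | yes _ = refl
    ... | no Y≢⊥ = cong 𝟙 (dec-false (allowed Y ⊆? ⊥) (allowed-⊈⊥ Y Y≢⊥))

  demand-⊤ : demand (nonemptySubsets n) ⊤ ≡ ∑ˢ {n} (λ Y → 𝟙 (does (Y ≢⊥?)))
  demand-⊤ = trans (demand-nonempty ⊤) (sumBy-cong _ _ (allSubsets n)
    (λ Y → cong (λ b → if does (Y ≢⊥?) then 𝟙 b else 0) (dec-true (allowed Y ⊆? ⊤) Subsetₚ.⊆⊤)))

  demand-bound : ∀ K → demand (nonemptySubsets n) K ≤ ℓ + (2 ^ ∣ K ∣ ∸ 1)
  demand-bound K = begin
    demand (nonemptySubsets n) K
      ≡⟨ demand-nonempty K ⟩
    ∑ˢ (λ Y → if does (Y ≢⊥?) then 𝟙 (does (allowed Y ⊆? K)) else 0)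
      ≤⟨ sumBy-mono-≤ _ _ (allSubsets n) (λ Y → lift (does (Y ≢⊥?)) (allowed-⊆-bound Y K)) ⟩
    ∑ˢ (λ Y → (if does (Y ≢⊥?) then 𝟙 (does (Y ⊆? K)) else 0) + 𝟙 (does (prescribed? Y)))
      ≡⟨ sumBy-distrib-+ _ _ (allSubsets n) ⟩
    ∑ˢ (λ Y → if does (Y ≢⊥?) then 𝟙 (does (Y ⊆? K)) else 0) + ∑ˢ (λ Y → 𝟙 (does (prescribed? Y)))
      ≤⟨ +-mono-≤ (≤-reflexive nonempty-subsets-of-K) prescribed-count ⟩
    (2 ^ ∣ K ∣ ∸ 1) + ℓ
      ≡⟨ +-comm _ ℓ ⟩
    ℓ + (2 ^ ∣ K ∣ ∸ 1) ∎
    where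
    open ≤-Reasoning
    lift : ∀ b {a a′ p} → a ≤ a′ + p → (if b then a else 0) ≤ (if b then a′ else 0) + p
    lift true a≤ = a≤
    lift false _ = z≤n
    nonempty-subsets-of-K : ∑ˢ (λ Y → if does (Y ≢⊥?) then 𝟙 (does (Y ⊆? K)) else 0) ≡ 2 ^ ∣ K ∣ ∸ 1
    nonempty-subsets-of-K = trans (sym (m+n∸n≡m _ 1)) (cong (_∸ 1) (∑ˢ-nonempty-⊆ K))

  hall-condition : ∀ (S : Vec ℕ n) → Vec.sum S + 1 ≡ 2 ^ n → (∀ k → 1 ≤ k → k < n → ExcessAtLeast S k ℓ) →
    HallCondition (nonemptySubsets n) S
  hall-condition S sum-S excess K with ∣ K ∣ ≟ 0 | ∣ K ∣ ≟ n
  ... | yes ∣K∣≡0 | _ = subst (λ K → demand (nonemptySubsets n) K ≤ sumOver K S) (sym (∣X∣≡0⇒X≡⊥ K ∣K∣≡0))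
    (≤-trans (≤-reflexive demand-⊥) z≤n)
  ... | no _ | yes ∣K∣≡n = subst (λ K → demand (nonemptySubsets n) K ≤ sumOver K S) (sym (Subsetₚ.∣p∣≡n⇒p≡⊤ ∣K∣≡n))
    (≤-reflexive (trans demand-⊤ (trans (nonempty-count≡sum S sum-S) (sym (sumOver-⊤ S)))))
  ... | no ∣K∣≢0 | no ∣K∣≢n = ≤-trans (demand-bound K)
    (excess ∣ K ∣ (n≢0⇒n>0 ∣K∣≢0) (≤∧≢⇒< (Subsetₚ.∣p∣≤n K) ∣K∣≢n) K refl)

  module Chosen (c : Subset n → Fin n) (c∈allowed : ∀ Y → Y ∈ₗ nonemptySubsets n → c Y ∈ allowed Y) where

    c∈ : ∀ Y → Y ≢ ⊥ → lookup Y (c Y) ≡ true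
    c∈ Y Y≢⊥ = Vecₚ.[]=⇒lookup (allowed-⊆ Y (c∈allowed Y (∈-nonemptySubsets Y≢⊥)))

    c-prescribed : ∀ t → c (X t) ≡ x t
    c-prescribed t = Subsetₚ.x∈⁅y⁆⇒x≡y (x t) (subst (c (X t) ∈_) (allowed-prescribed t)
      (c∈allowed (X t) (∈-nonemptySubsets (∈⇒≢⊥ (X t) (Vecₚ.[]=⇒lookup (x∈X t))))))

-- Nonemptiness of X t already follows from x t ∈ X t; 1 ≤ ℓ only supplies x zero as the
-- irrelevant value of c at ∅.
theorem5p6 : (n ℓ : ℕ) → 1 ≤ ℓ → (S : Vec ℕ n) → IsSignature S
    → (∀ k → 1 ≤ k → k < n → ExcessAtLeast S k ℓ)
    → (X : Fin ℓ → Subset n) → (∀ s t → X s ≡ X t → s ≡ t)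
    → (∀ t → Nonempty (X t))
    → (x : Fin ℓ → Fin n) → (∀ t → x t ∈ X t)
    → Σ (EdgeSet n) λ T → IsSpanningTree T × Upright T × sig T ≡ S
    × (∀ t → PsiIs T (X t) (x t))
theorem5p6 n (suc ℓ) _ S sig-S excess X X-injective _ x x∈X =
  T , (isEdgeSet , connected , acyclic) , upright , sig-T≡S ,
  λ t → ψ (X t) (Vecₚ.[]=⇒lookup (x∈X t)) (c-prescribed t)
  where
  open Prescribed X X-injective x x∈X
  sum-S = signature-sum sig-S
  chosen = hall (x zero) (nonemptySubsets n) (nonemptySubsets-unique n) S (hall-condition S sum-S excess)
  c = proj₁ chosen
  open Chosen c (proj₁ (proj₂ chosen))
  open ParentTree c c∈
  sig-T≡S : sig T ≡ S
  sig-T≡S = trans (Vecₚ.tabulate-cong (λ j → trans (dirCount-parentTree j) (load-exact c S sum-S (proj₂ (proj₂ chosen)) j)))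
                  (Vecₚ.tabulate∘lookup S)
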